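{- Let $T$ be a functional non-deterministic register transducer with $k$ registers, defining the function $f$. Then for every $X\subseteq\mathcal{D}$ with $|X|\geq2k+3$ and $d_0\in X$: $f$ is not continuous at some $x\in(\Sigma\times\mathcal{D})^\omega$ if and only if $f$ is not continuous at some $z\in(\Sigma\times X)^\omega$.
   Context: Fix finite alphabets $\Sigma,\Gamma$, a countably infinite set $\mathcal{D}$ of data values and a distinguished $d_0\in\mathcal{D}$. A test over a finite register set $R$ is a Boolean combination of $\top,\bot,r^{=},r^{\neq}$ ($r\in R$); for $\tau:R\to\mathcal{D}$ and $d\in\mathcal{D}$, $\tau,d\models r^{=}$ iff $\tau(r)=d$, $\tau,d\models r^{\neq}$ iff $\tau(r)\neq d$. A non-deterministic register transducer (NRT) is $T=(Q,R,i_0,F,\Delta)$ with finite states $Q$, initial $i_0$, accepting $F\subseteq Q$, finite register set $R$ ($k=|R|$), and finite $\Delta\subseteq Q\times\Sigma\times\mathrm{Tests}_R\times2^R\times(\Gamma\times R)^*\times Q$. From configuration $(q,\tau)$, reading $(\sigma,d)$, a transition $(q,\sigma,\phi,\mathrm{asgn},o,q')$ with $\tau,d\models\phi$ leads to $(q',\tau')$ with $\tau'(r)=d$ if $r\in\mathrm{asgn}$ and $\tau'(r)=\tau(r)$ otherwise, outputting $(\gamma_1,\tau'(r_1))\cdots(\gamma_m,\tau'(r_m))$ where $o=(\gamma_1,r_1)\cdots(\gamma_m,r_m)$. An accepting run starts in $i_0$ with all registers equal to $d_0$ and visits $F$ infinitely often; standing assumption: accepting runs produce infinite outputs. $T$ is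 functional if the set of (input, output) pairs of accepting runs is the graph of a partial function $f$. $f$ is continuous at $x\in\mathrm{dom}(f)$ if for all $i\geq0$ there is $j\geq0$ such that for all $y\in\mathrm{dom}(f)$, $|x\wedge y|\geq j$ implies $|f(x)\wedge f(y)|\geq i$, where $\wedge$ is longest common prefix; "not continuous at $x$" is only meant for $x\in\mathrm{dom}(f)$. -}

module Defs where

open import Data.Nat using (ℕ; zero; suc; _≤_; _<_)
open import Data.Fin using (Fin)
open import Data.Bool using (Bool; true; false; if_then_else_)
open import Data.List using (List; []; _∷_; _++_; map; length)
open import Data.List.Membership.Propositional using (_∈_)
open import Data.List.Relation.Unary.All using (All)
open import Data.List.Relation.Unary.Unique.Propositional using (Unique)
open import Data.Product using (Σ; ∃; ∃-syntax; _×_; _,_; proj₁; proj₂)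
open import Relation.Binary.PropositionalEquality using (_≡_; _≢_)
open import Relation.Nullary using (¬_)
open import Data.Unit using (⊤)
open import Data.Empty using (⊥)
open import Data.Sum using (_⊎_)

-- Data values: 𝒟 = ℕ (a countably infinite set with decidable equality).
-- Input alphabet Σ = Fin s, output alphabet Γ = Fin g, registers R = Fin k.

Valuation : ℕ → Set
Valuation k = Fin k → ℕ

data Test (k : ℕ) : Set where
  tt ff      : Test k
  req rneq   : Fin k → Test k
  tnot       : Test k → Test k
  tand tor   : Test k → Test k → Test k

_,_⊨_ : ∀ {k} → Valuation k → ℕ → Test k → Set
τ , d ⊨ tt = ⊤
τ , d ⊨ ff = ⊥
τ , d ⊨ req r = τ r ≡ d
τ , d ⊨ rneq r = τ r ≢ d
τ , d ⊨ tnot φ = ¬ (τ , d ⊨ φ)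
τ , d ⊨ tand φ ψ = (τ , d ⊨ φ) × (τ , d ⊨ ψ)
τ , d ⊨ tor φ ψ = (τ , d ⊨ φ) ⊎ (τ , d ⊨ ψ)

-- A transition (p, σ, φ, asgn, o, p'); asgn ⊆ R given as a characteristic function.
record Transition (s g k q : ℕ) : Set where
  constructor mkTrans
  field
    src  : Fin q
    lab  : Fin s
    test : Test k
    asgn : Fin k → Bool
    out  : List (Fin g × Fin k)
    tgt  : Fin q

record NRT (s g k : ℕ) : Set where
  field
    nstates : ℕ
    init    : Fin nstates
    final   : Fin nstates → Bool
    Δ       : List (Transition s g k nstates)

open NRT public
open Transition public

Word : Set → Set
Word A = ℕ → A

InWord : ℕ → Set
InWord s = Word (Fin s × ℕ)

OutWord : ℕ → Set
OutWord g = Word (Fin g × ℕ)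

update : ∀ {k} → Valuation k → (Fin k → Bool) → ℕ → Valuation k
update τ a d r = if a r then d else τ r

module _ {s g k : ℕ} (T : NRT s g k) (d₀ : ℕ) where

  Trans : Set
  Trans = Transition s g k (nstates T)

  -- register valuation before reading position i, for a given transition sequence
  regs : InWord s → (ℕ → Trans) → ℕ → Valuation k
  regs x t zero = λ _ → d₀
  regs x t (suc i) = update (regs x t i) (asgn (t i)) (proj₂ (x i))

  record Run (x : InWord s) : Set where
    field
      trans  : ℕ → Trans
      inΔ    : ∀ i → trans i ∈ Δ T
      start  : src (trans 0) ≡ init T
      chain  : ∀ i → tgt (trans i) ≡ src (trans (suc i))
      label  : ∀ i → lab (trans i) ≡ proj₁ (x i)
      tests  : ∀ i → regs x trans i , proj₂ (x i) ⊨ test (trans i)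

  open Run public

  -- state at position i is src (trans i)
  Accepting : ∀ {x} → Run x → Set
  Accepting {x} ρ = ∀ n → ∃[ m ] (n ≤ m × final T (src (trans ρ m)) ≡ true)

  block : ∀ {x} → Run x → ℕ → List (Fin g × ℕ)
  block {x} ρ i = map (λ p → proj₁ p , regs x (trans ρ) (suc i) (proj₂ p)) (out (trans ρ i))

  outPrefix : ∀ {x} → Run x → ℕ → List (Fin g × ℕ)
  outPrefix ρ zero = []
  outPrefix ρ (suc n) = outPrefix ρ n ++ block ρ n

  prefix : ∀ {A : Set} → Word A → ℕ → List A
  prefix w zero = []
  prefix w (suc n) = prefix w n ++ (w n ∷ [])

  Produces : ∀ {x} → Run x → OutWord g → Set
  Produces ρ y = ∀ n → outPrefix ρ n ≡ prefix y (length (outPrefix ρ n))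

  InfiniteOutput : ∀ {x} → Run x → Set
  InfiniteOutput ρ = ∀ m → ∃[ n ] (m ≤ length (outPrefix ρ n))

  StandingAssumption : Set
  StandingAssumption = ∀ x (ρ : Run x) → Accepting ρ → InfiniteOutput ρ

  Graph : InWord s → OutWord g → Set
  Graph x y = Σ (Run x) λ ρ → Accepting ρ × Produces ρ y

  Functional : Set
  Functional = ∀ x y y′ → Graph x y → Graph x y′ → ∀ i → y i ≡ y′ i

  Dom : InWord s → Set
  Dom x = ∃[ y ] Graph x y

  Agree : ∀ {A : Set} → ℕ → Word A → Word A → Set
  Agree n u v = ∀ i → i < n → u i ≡ v i

  ContinuousAt : InWord s → Set
  ContinuousAt x = ∀ i → ∃[ j ] (∀ x′ y y′ → Graph x y → Graph x′ y′ →
                                   Agree j x x′ → Agree i y y′)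

  NotContinuousAt : InWord s → Set
  NotContinuousAt x = Dom x × ¬ ContinuousAt x

AtLeast : ℕ → (ℕ → Set) → Set
AtLeast n X = ∃[ xs ] (n ≤ length xs × Unique xs × All X xs)

module Submission where

-- Discontinuity at a word with data in X is discontinuity, so only the
-- forward direction has content.  If f is discontinuous at x, f(x) = y, there is an
-- output length i such that for every j some x′ⱼ agrees with x on j letters and has
-- an image differing from y at a position pⱼ < i.  Classically, one position p*
-- recurs for unboundedly many j (pigeonhole), and since Δ is finite some transition
-- sequence π has each prefix shared by the runs on unboundedly many such x′ⱼ (König).
-- Renaming the data of x letter by letter along the tracks (run of x, π) so that each
-- datum keeps its equality type w.r.t. the 2k registers and the pinned datum of
-- y(p*) needs at most 2k + 3 values of X.  Tests only see equality types, so runs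
-- transfer to the renamed word z with correspondingly renamed outputs; renaming x′ⱼ
-- along (run of x, run of x′ⱼ) gives words ever closer to z whose images still
-- differ from that of z at p*.

open import Defs
open import Level using (0ℓ)
open import Axiom.ExcludedMiddle using (ExcludedMiddle)
open import Data.Nat using (ℕ; zero; suc; _≤_; _<_; z≤n; s≤s; _≟_; _<?_; _+_; _∸_; _*_)
open import Data.Nat.Properties
  using (≤-refl; ≤-trans; <⇒≤; m∸n+n≡m; ≤-total; <-≤-trans; ≤-<-trans; ≮⇒≥; m≤m+n; m≤n+m;
         n≤1+n; <-irrefl; +-comm; +-identityʳ; m<1+n⇒m<n∨m≡n)
open import Data.Fin using (Fin)
open import Data.Fin.Properties using (any?)
open import Data.Vec using (Vec; tabulate; lookup)
open import Data.Vec.Properties using (tabulate-cong; lookup∘tabulate)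
open import Data.Bool using (Bool; true; false; if_then_else_)
open import Data.Maybe using (Maybe; just; nothing)
open import Data.List as List using (List; []; _∷_; _++_; length; upTo)
open import Data.List.Properties using (++-assoc; ++-identityʳ; length-++; length-tabulate)
open import Data.List.Membership.Propositional using (_∈_; _∉_; find)
open import Data.List.Membership.DecPropositional _≟_ using (_∈?_)
open import Data.List.Membership.Propositional.Properties
  using (∈-tabulate⁺; ∈-++⁺ˡ; ∈-++⁺ʳ; ∈-upTo⁺; ∈-upTo⁻)
open import Data.List.Relation.Unary.Any using (here; there)
open import Data.List.Relation.Unary.All as All using (All; all?)
open import Data.List.Relation.Unary.All.Properties using (¬All⇒Any¬)
open import Data.List.Relation.Unary.AllPairs using (_∷_)
open import Data.List.Relation.Unary.Unique.Propositional using (Unique)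
open import Data.List.Relation.Binary.Pointwise as Pointwise using (Pointwise; []; _∷_)
open import Data.List.Relation.Binary.Pointwise.Properties
  using (Pointwise-length) renaming (refl to Pointwise-refl)
open import Data.Product using (Σ; ∃; ∃-syntax; _×_; _,_; proj₁; proj₂)
open import Data.Sum using (_⊎_; inj₁; inj₂)
open import Data.Empty using (⊥-elim)
open import Data.Unit using (⊤) renaming (tt to ⋆)
open import Data.Product.Function.NonDependent.Propositional using (_×-⇔_)
open import Data.Sum.Function.Propositional using (_⊎-⇔_)
open import Function.Related.TypeIsomorphisms using (¬-cong-⇔)
open import Function using (_∘′_)
open import Function.Bundles using (_⇔_; mk⇔; Equivalence)
open import Relation.Nullary using (¬_; yes; no)
open import Relation.Binary.PropositionalEquality
  using (_≡_; _≢_; refl; sym; cong; cong₂; subst; subst₂; module ≡-Reasoning)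
  renaming (trans to ≡-trans)

open Equivalence using (to; from)

_!?_ : ∀ {A : Set} → List A → ℕ → Maybe A
[] !? p = nothing
(a ∷ as) !? zero = just a
(a ∷ as) !? suc p = as !? p

!?-++ˡ : ∀ {A : Set} (as bs : List A) {p} → p < length as → (as ++ bs) !? p ≡ as !? p
!?-++ˡ (a ∷ as) bs {zero} _ = refl
!?-++ˡ (a ∷ as) bs {suc p} (s≤s p<) = !?-++ˡ as bs p<

!?-beyond : ∀ {A : Set} (as : List A) {p} → length as ≤ p → as !? p ≡ nothing
!?-beyond [] _ = refl
!?-beyond (a ∷ as) {suc p} (s≤s ≤p) = !?-beyond as ≤p

!?-within : ∀ {A : Set} (as : List A) {p} → p < length as → ∃[ a ] (as !? p ≡ just a)
!?-within (a ∷ as) {zero} _ = a , refl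
!?-within (a ∷ as) {suc p} (s≤s p<) = !?-within as p<

!?-snoc : ∀ {A : Set} (as : List A) a → (as ++ a ∷ []) !? length as ≡ just a
!?-snoc [] a = refl
!?-snoc (b ∷ as) a = !?-snoc as a

!?-ext : ∀ {A : Set} (as bs : List A) → (∀ p → as !? p ≡ bs !? p) → as ≡ bs
!?-ext [] [] _ = refl
!?-ext [] (b ∷ bs) same with () ← same zero
!?-ext (a ∷ as) [] same with () ← same zero
!?-ext (a ∷ as) (b ∷ bs) same with refl ← same zero =
  cong (a ∷_) (!?-ext as bs (λ p → same (suc p)))

Pointwise-!? : ∀ {A B : Set} {R : A → B → Set} {as bs} → Pointwise R as bs →
  ∀ p {a b} → as !? p ≡ just a → bs !? p ≡ just b → R a b
Pointwise-!? (r ∷ _) zero refl refl = r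
Pointwise-!? (_ ∷ rs) (suc p) eq eq′ = Pointwise-!? rs p eq eq′

module Runs {s g k : ℕ} (T : NRT s g k) (d₀ : ℕ) where

  length-prefix : ∀ {A : Set} (w : Word A) n → length (prefix T d₀ w n) ≡ n
  length-prefix w zero = refl
  length-prefix w (suc n) = begin
    length (prefix T d₀ w n ++ w n ∷ [])   ≡⟨ length-++ (prefix T d₀ w n) ⟩
    length (prefix T d₀ w n) + 1           ≡⟨ cong (_+ 1) (length-prefix w n) ⟩
    n + 1                                  ≡⟨ +-comm n 1 ⟩
    suc n                                  ∎
    where open ≡-Reasoning

  prefix-!? : ∀ {A : Set} (w : Word A) n p → p < n → prefix T d₀ w n !? p ≡ just (w p)
  prefix-!? w (suc n) p p< with m<1+n⇒m<n∨m≡n p<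
  ... | inj₁ p<n = ≡-trans
    (!?-++ˡ (prefix T d₀ w n) _ (subst (p <_) (sym (length-prefix w n)) p<n)) (prefix-!? w n p p<n)
  ... | inj₂ refl = subst (λ q → (prefix T d₀ w p ++ w p ∷ []) !? q ≡ just (w p))
                          (length-prefix w p) (!?-snoc (prefix T d₀ w p) (w p))

  module Output {x : InWord s} (ρ : Run T d₀ x) where

    O : ℕ → List (Fin g × ℕ)
    O = outPrefix T d₀ ρ

    outPrefix-extends : ∀ n e → ∃[ r ] (O (e + n) ≡ O n ++ r)
    outPrefix-extends n zero = [] , sym (++-identityʳ (O n))
    outPrefix-extends n (suc e) with r , eq ← outPrefix-extends n e =
      r ++ block T d₀ ρ (e + n) , ≡-trans (cong (_++ block T d₀ ρ (e + n)) eq) (++-assoc (O n) r _)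

    outPrefix-stable : ∀ {n m} p → n ≤ m → p < length (O n) → O m !? p ≡ O n !? p
    outPrefix-stable {n} {m} p n≤m p< with r , eq ← outPrefix-extends n (m ∸ n)
      rewrite m∸n+n≡m n≤m = ≡-trans (cong (_!? p) eq) (!?-++ˡ (O n) r p<)

    produces-!? : ∀ {y} → Produces T d₀ ρ y → ∀ n p → p < length (O n) → O n !? p ≡ just (y p)
    produces-!? {y} pr n p p< = ≡-trans (cong (_!? p) (pr n)) (prefix-!? y _ p p<)

    -- A run with infinite output produces a word: its p-th letter is read off any
    -- output prefix that is long enough.
    output-word : InfiniteOutput T d₀ ρ → ∃[ y ] Produces T d₀ ρ y
    output-word inf = y , produces
      where
      long : ℕ → ℕ
      long p = proj₁ (inf (suc p))

      y : OutWord g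
      y p = proj₁ (!?-within (O (long p)) (proj₂ (inf (suc p))))

      y-entry : ∀ p → O (long p) !? p ≡ just (y p)
      y-entry p = proj₂ (!?-within (O (long p)) (proj₂ (inf (suc p))))

      entry : ∀ n p → p < length (O n) → O n !? p ≡ just (y p)
      entry n p p< with ≤-total n (long p)
      ... | inj₁ n≤ = ≡-trans (sym (outPrefix-stable p n≤ p<)) (y-entry p)
      ... | inj₂ ≥n = ≡-trans (outPrefix-stable p ≥n (proj₂ (inf (suc p)))) (y-entry p)

      produces : ∀ n → O n ≡ prefix T d₀ y (length (O n))
      produces n = !?-ext _ _ same
        where
        same : ∀ p → O n !? p ≡ prefix T d₀ y (length (O n)) !? p
        same p with p <? length (O n)
        ... | yes p< = ≡-trans (entry n p p<) (sym (prefix-!? y _ p p<))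
        ... | no p≮ = ≡-trans (!?-beyond (O n) (≮⇒≥ p≮))
                        (sym (!?-beyond (prefix T d₀ y (length (O n)))
                               (subst (_≤ p) (sym (length-prefix y _)) (≮⇒≥ p≮))))

  outputs-related : ∀ {x x′} (ρ : Run T d₀ x) (ρ′ : Run T d₀ x′)
    {R : (Fin g × ℕ) → (Fin g × ℕ) → Set} {y y′} →
    InfiniteOutput T d₀ ρ → Produces T d₀ ρ y → Produces T d₀ ρ′ y′ →
    (∀ n → Pointwise R (outPrefix T d₀ ρ n) (outPrefix T d₀ ρ′ n)) → ∀ p → R (y p) (y′ p)
  outputs-related ρ ρ′ inf pr pr′ rel p with n , p< ← inf (suc p) =
    Pointwise-!? (rel n) p (Output.produces-!? ρ pr n p p<)
      (Output.produces-!? ρ′ pr′ n p (subst (p <_) (Pointwise-length (rel n)) p<))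

  regs-local : ∀ (x x′ : InWord s) (A A′ : ℕ → Trans T d₀) n →
    (∀ t → t < n → proj₂ (x t) ≡ proj₂ (x′ t)) → (∀ t → t < n → A t ≡ A′ t) →
    ∀ t → t ≤ n → ∀ r → regs T d₀ x A t r ≡ regs T d₀ x′ A′ t r
  regs-local x x′ A A′ n same-x same-A zero _ r = refl
  regs-local x x′ A A′ n same-x same-A (suc t) t< r
    rewrite same-A t t< | same-x t t< | regs-local x x′ A A′ n same-x same-A t (<⇒≤ t<) r = refl

test-transfer : ∀ {k} (τ τ′ : Valuation k) (d d′ : ℕ) →
  (∀ r → (τ r ≡ d) ⇔ (τ′ r ≡ d′)) → ∀ φ → (τ , d ⊨ φ) ⇔ (τ′ , d′ ⊨ φ)
test-transfer τ τ′ d d′ same = go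
  where
  go : ∀ φ → (τ , d ⊨ φ) ⇔ (τ′ , d′ ⊨ φ)
  go tt = mk⇔ (λ u → u) (λ u → u)
  go ff = mk⇔ (λ u → u) (λ u → u)
  go (req r) = same r
  go (rneq r) = ¬-cong-⇔ (same r)
  go (tnot φ) = ¬-cong-⇔ (go φ)
  go (tand φ ψ) = go φ ×-⇔ go ψ
  go (tor φ ψ) = go φ ⊎-⇔ go ψ

-- A supply of target values for renaming into X relative to a pinned datum v: a
-- partner for v (equal to d₀ exactly when v is) and, for any two valuations, a value
-- of X different from the partner and from every register content.
record Supply (k : ℕ) (X : ℕ → Set) (d₀ v : ℕ) : Set where
  field
    partner : ℕ
    partner∈X : X partner
    partner≡d₀ : (v ≡ d₀) ⇔ (partner ≡ d₀)
    fresh : Valuation k → Valuation k → ℕ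
    fresh∈X : ∀ τ σ → X (fresh τ σ)
    fresh-new : ∀ τ σ → fresh τ σ ∉ partner ∷ List.tabulate τ ++ List.tabulate σ

-- Renaming the data of an input word along two transition sequences ("tracks") so
-- that every datum keeps its equality type with respect to the pinned value v and the
-- registers of both tracks.
module Renaming {s g k : ℕ} (T : NRT s g k) (d₀ : ℕ) (X : ℕ → Set) (X-d₀ : X d₀)
                (v : ℕ) (S : Supply k X d₀ v) where
  open Supply S
  open Runs T d₀

  -- The values compared by tests: the pinned value and the registers of both tracks.
  data Slot : Set where
    pin : Slot
    reg : Bool → Fin k → Slot

  slots : ℕ → (Bool → Valuation k) → Slot → ℕ
  slots p τ pin = p
  slots p τ (reg b r) = τ b r

  SameType : (Slot → ℕ) → (Slot → ℕ) → Set
  SameType o n = ∀ a b → (o a ≡ o b) ⇔ (n a ≡ n b)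

  InX : (Slot → ℕ) → Set
  InX n = ∀ a → X (n a)

  Matches : (Slot → ℕ) → (Slot → ℕ) → ℕ → ℕ → Set
  Matches o n d d′ = ∀ a → (o a ≡ d) ⇔ (n a ≡ d′)

  -- The renaming of a datum d: copy the renamed content of a slot holding d, else
  -- take a fresh value.  Slot contents are passed as tables so that the choice
  -- depends only on their entries.
  choose : ℕ → (oa ob na nb : Vec ℕ k) → ℕ
  choose d oa ob na nb with any? (λ r → lookup oa r ≟ d)
  ... | yes (r , _) = lookup na r
  ... | no _ with any? (λ r → lookup ob r ≟ d)
  ...   | yes (r , _) = lookup nb r
  ...   | no _ with v ≟ d
  ...     | yes _ = partner
  ...     | no _ = fresh (lookup na) (lookup nb)

  slot-matches : ∀ {o n} → SameType o n → InX n → ∀ a → Matches o n (o a) (n a) × X (n a)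
  slot-matches same inX a = (λ b → same b a) , inX a

  choose-matches : ∀ d oa ob na nb (τ σ : Bool → Valuation k) →
    (∀ q → lookup oa q ≡ τ true q) → (∀ q → lookup ob q ≡ τ false q) →
    (∀ q → lookup na q ≡ σ true q) → (∀ q → lookup nb q ≡ σ false q) →
    SameType (slots v τ) (slots partner σ) → InX (slots partner σ) →
    Matches (slots v τ) (slots partner σ) d (choose d oa ob na nb) × X (choose d oa ob na nb)
  choose-matches d oa ob na nb τ σ oa≡ ob≡ na≡ nb≡ same inX
    with any? (λ q → lookup oa q ≟ d)
  ... | yes (q , held) = subst₂ (λ e e′ → Matches (slots v τ) (slots partner σ) e e′ × X e′)
                           (≡-trans (sym (oa≡ q)) held) (sym (na≡ q)) (slot-matches same inX (reg true q))
  ... | no ¬a with any? (λ q → lookup ob q ≟ d)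
  ...   | yes (q , held) = subst₂ (λ e e′ → Matches (slots v τ) (slots partner σ) e e′ × X e′)
                           (≡-trans (sym (ob≡ q)) held) (sym (nb≡ q)) (slot-matches same inX (reg false q))
  ...   | no ¬b with v ≟ d
  ...     | yes refl = slot-matches same inX pin
  ...     | no v≢d = (λ b → mk⇔ (⊥-elim ∘′ not-held b) (⊥-elim ∘′ not-fresh b)) , fresh∈X _ _
    where
    not-held : ∀ b → slots v τ b ≢ d
    not-held pin = v≢d
    not-held (reg true q) eq = ¬a (q , ≡-trans (oa≡ q) eq)
    not-held (reg false q) eq = ¬b (q , ≡-trans (ob≡ q) eq)

    not-fresh : ∀ b → slots partner σ b ≢ fresh (lookup na) (lookup nb)
    not-fresh pin eq = fresh-new _ _ (here (sym eq))
    not-fresh (reg true q) eq = fresh-new _ _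
      (there (∈-++⁺ˡ (subst (_∈ List.tabulate (lookup na)) (≡-trans (na≡ q) eq)
                           (∈-tabulate⁺ q))))
    not-fresh (reg false q) eq = fresh-new _ _
      (there (∈-++⁺ʳ (List.tabulate (lookup na))
                     (subst (_∈ List.tabulate (lookup nb)) (≡-trans (nb≡ q) eq) (∈-tabulate⁺ q))))

  assign-preserves : ∀ (o n : Slot → ℕ) d d′ (asg : Slot → Bool) (o′ n′ : Slot → ℕ) →
    SameType o n → InX n → Matches o n d d′ → X d′ →
    (∀ a → o′ a ≡ (if asg a then d else o a)) → (∀ a → n′ a ≡ (if asg a then d′ else n a)) →
    SameType o′ n′ × InX n′
  assign-preserves o n d d′ asg o′ n′ same inX match d′∈X o′≡ n′≡ = same′ , inX′
    where
    same′ : SameType o′ n′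
    same′ a b rewrite o′≡ a | o′≡ b | n′≡ a | n′≡ b with asg a | asg b
    ... | true  | true  = mk⇔ (λ _ → refl) (λ _ → refl)
    ... | true  | false = mk⇔ (λ e → sym (to (match b) (sym e)))
                                (λ e → sym (from (match b) (sym e)))
    ... | false | true  = match a
    ... | false | false = same a b

    inX′ : InX n′
    inX′ a rewrite n′≡ a with asg a
    ... | true = d′∈X
    ... | false = inX a

  Corresponds : (Fin g × ℕ) → (Fin g × ℕ) → Set
  Corresponds e e′ = (proj₁ e ≡ proj₁ e′) × ((proj₂ e ≡ v) ⇔ (proj₂ e′ ≡ partner))

  corresponds-separates : ∀ {e e′ f f′} → Corresponds e e′ → Corresponds f f′ →
    proj₂ e ≡ v → e ≢ f → e′ ≢ f′
  corresponds-separates (γ≡ , e⇔) (δ≡ , f⇔) e-pinned e≢f refl =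
    e≢f (cong₂ _,_ (≡-trans γ≡ (sym δ≡)) (≡-trans e-pinned (sym (from f⇔ (to e⇔ e-pinned)))))

  module Renamed (x : InWord s) (A B : ℕ → Trans T d₀) where

    track : Bool → ℕ → Trans T d₀
    track true = A
    track false = B

    original : ℕ → Bool → Valuation k
    original t b = regs T d₀ x (track b) t

    mutual
      renamed : ℕ → Bool → Valuation k
      renamed zero b r = d₀
      renamed (suc t) b = update (renamed t b) (asgn (track b t)) (datum t)

      datum : ℕ → ℕ
      datum t = choose (proj₂ (x t)) (tabulate (original t true)) (tabulate (original t false))
                       (tabulate (renamed t true)) (tabulate (renamed t false))

    z : InWord s
    z t = proj₁ (x t) , datum t

    -- Invariant: before each step the original and renamed slots have the same
    -- equality type, so the renamed datum matches the original one.
    invariant : ∀ t → SameType (slots v (original t)) (slots partner (renamed t))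
                    × InX (slots partner (renamed t))
    datum-matches : ∀ t → Matches (slots v (original t)) (slots partner (renamed t))
                                  (proj₂ (x t)) (datum t) × X (datum t)

    datum-matches t = choose-matches (proj₂ (x t)) _ _ _ _ (original t) (renamed t)
      (lookup∘tabulate _) (lookup∘tabulate _) (lookup∘tabulate _) (lookup∘tabulate _)
      (proj₁ (invariant t)) (proj₂ (invariant t))

    invariant zero = same , inX
      where
      same : SameType (slots v (original zero)) (slots partner (renamed zero))
      same pin pin = mk⇔ (λ _ → refl) (λ _ → refl)
      same pin (reg _ _) = partner≡d₀
      same (reg _ _) pin = mk⇔ (λ e → sym (to partner≡d₀ (sym e)))
                               (λ e → sym (from partner≡d₀ (sym e)))
      same (reg _ _) (reg _ _) = mk⇔ (λ _ → refl) (λ _ → refl)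

      inX : InX (slots partner (renamed zero))
      inX pin = partner∈X
      inX (reg _ _) = X-d₀
    invariant (suc t) = assign-preserves _ _ _ _ assigned _ _
      (proj₁ (invariant t)) (proj₂ (invariant t)) (proj₁ (datum-matches t)) (proj₂ (datum-matches t))
      original-step renamed-step
      where
      assigned : Slot → Bool
      assigned pin = false
      assigned (reg b r) = asgn (track b t) r

      original-step : ∀ a → slots v (original (suc t)) a
                            ≡ (if assigned a then proj₂ (x t) else slots v (original t) a)
      original-step pin = refl
      original-step (reg b r) = refl

      renamed-step : ∀ a → slots partner (renamed (suc t)) a
                           ≡ (if assigned a then datum t else slots partner (renamed t) a)
      renamed-step pin = refl
      renamed-step (reg b r) = refl

    regs-renamed : ∀ b t r → regs T d₀ z (track b) t r ≡ renamed t b r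
    regs-renamed b zero r = refl
    regs-renamed b (suc t) r rewrite regs-renamed b t r = refl

    module Follow (b : Bool) (ρ : Run T d₀ x) (follows : ∀ t → trans ρ t ≡ track b t) where

      relate : ∀ i r {d d′} → (original i b r ≡ d) ⇔ (renamed i b r ≡ d′) →
        (regs T d₀ x (trans ρ) i r ≡ d) ⇔ (regs T d₀ z (trans ρ) i r ≡ d′)
      relate i r {d} {d′} = subst₂ (λ u w → (u ≡ d) ⇔ (w ≡ d′)) (sym original≡) (sym renamed≡)
        where
        original≡ : regs T d₀ x (trans ρ) i r ≡ original i b r
        original≡ = regs-local x x (trans ρ) (track b) i (λ _ _ → refl) (λ t _ → follows t) i ≤-refl r

        renamed≡ : regs T d₀ z (trans ρ) i r ≡ renamed i b r
        renamed≡ = ≡-trans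
          (regs-local z z (trans ρ) (track b) i (λ _ _ → refl) (λ t _ → follows t) i ≤-refl r)
          (regs-renamed b i r)

      -- The same transitions form a run on z, since every test sees the same equalities.
      run : Run T d₀ z
      run = record { trans = trans ρ ; inΔ = inΔ ρ ; start = start ρ ; chain = chain ρ
                   ; label = label ρ ; tests = passes }
        where
        passes : ∀ i → regs T d₀ z (trans ρ) i , datum i ⊨ test (trans ρ i)
        passes i = to (test-transfer _ _ (proj₂ (x i)) (datum i)
                        (λ r → relate i r (proj₁ (datum-matches i) (reg b r))) (test (trans ρ i)))
                      (tests ρ i)

      -- Each output datum is a register; it equals v iff its renaming equals the partner.
      outputs-correspond : ∀ n → Pointwise Corresponds (outPrefix T d₀ ρ n) (outPrefix T d₀ run n)
      outputs-correspond zero = []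
      outputs-correspond (suc n) =
        Pointwise.++⁺ (outputs-correspond n)
          (Pointwise.map⁺ _ _ (Pointwise-refl λ {(_ , r)} →
            refl , relate (suc n) r (proj₁ (invariant (suc n)) (reg b r) pin)))

      renamed-graph : StandingAssumption T d₀ → ∀ {y} → Accepting T d₀ ρ → Produces T d₀ ρ y →
        ∃[ y′ ] (Graph T d₀ z y′ × ∀ p → Corresponds (y p) (y′ p))
      renamed-graph standing acc pr with y′ , pr′ ← Output.output-word run (standing z run acc) =
        y′ , (run , acc , pr′) ,
        outputs-related ρ run (standing x ρ acc) pr pr′ outputs-correspond

  renaming-causal : ∀ (x x′ : InWord s) (A A′ B B′ : ℕ → Trans T d₀) m →
    Agree T d₀ m x x′ → Agree T d₀ m A A′ → Agree T d₀ m B B′ →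
    Agree T d₀ m (Renamed.z x A B) (Renamed.z x′ A′ B′)
  renaming-causal x x′ A A′ B B′ m same-x same-A same-B t t<m =
    cong₂ _,_ (cong proj₁ (same-x t t<m)) (same-datum t t<m)
    where
    module R = Renamed x A B
    module R′ = Renamed x′ A′ B′

    same-track : ∀ b t → t < m → R.track b t ≡ R′.track b t
    same-track true = same-A
    same-track false = same-B

    same-original : ∀ t → t ≤ m → ∀ b r → R.original t b r ≡ R′.original t b r
    same-original t t≤m b r =
      regs-local x x′ (R.track b) (R′.track b) m (λ t t< → cong proj₂ (same-x t t<)) (same-track b)
                 t t≤m r

    mutual
      same-renamed : ∀ t → t ≤ m → ∀ b r → R.renamed t b r ≡ R′.renamed t b r
      same-renamed zero _ b r = refl
      same-renamed (suc t) t< b r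
        rewrite same-track b t t< | same-datum t t< | same-renamed t (<⇒≤ t<) b r = refl

      -- The renamed datum is computed from tables that agree entry by entry.
      same-datum : ∀ t → t < m → R.datum t ≡ R′.datum t
      same-datum t t<
        rewrite cong proj₂ (same-x t t<)
              | tabulate-cong (same-original t (<⇒≤ t<) true)
              | tabulate-cong (same-original t (<⇒≤ t<) false)
              | tabulate-cong (same-renamed t (<⇒≤ t<) true)
              | tabulate-cong (same-renamed t (<⇒≤ t<) false)
              = refl

module Classical (em : ExcludedMiddle 0ℓ) where

  double-negation : ∀ {P : Set} → ¬ ¬ P → P
  double-negation {P} ¬¬p with em {P}
  ... | yes p = p
  ... | no ¬p = ⊥-elim (¬¬p ¬p)

  ¬∀⇒∃¬ : ∀ {A : Set} {P : A → Set} → ¬ (∀ a → P a) → ∃ λ a → ¬ P a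
  ¬∀⇒∃¬ ¬∀ = double-negation (λ ¬∃ → ¬∀ (λ a → double-negation (λ ¬p → ¬∃ (a , ¬p))))

  ¬→⇒×¬ : ∀ {P Q : Set} → ¬ (P → Q) → P × ¬ Q
  ¬→⇒×¬ {P} ¬→ with em {P}
  ... | yes p = p , (λ q → ¬→ (λ _ → q))
  ... | no ¬p = ⊥-elim (¬→ (λ p → ⊥-elim (¬p p)))

  Unbounded : (ℕ → Set) → Set
  Unbounded P = ∀ m → ∃[ j ] (m ≤ j × P j)

  unbounded-mono : ∀ {P Q : ℕ → Set} → (∀ j → P j → Q j) → Unbounded P → Unbounded Q
  unbounded-mono P⇒Q unb m with j , m≤j , pj ← unb m = j , m≤j , P⇒Q j pj

  unbounded-split : ∀ {P Q : ℕ → Set} → Unbounded P → ¬ Unbounded (λ j → P j × Q j) →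
    Unbounded (λ j → P j × ¬ Q j)
  unbounded-split {P} {Q} unb ¬unb with m₀ , beyond ← ¬∀⇒∃¬ ¬unb = λ m →
    let (j , m+m₀≤j , pj) = unb (m + m₀) in
    j , ≤-trans (m≤m+n m m₀) m+m₀≤j , pj ,
    (λ qj → beyond (j , ≤-trans (m≤n+m m₀ m) m+m₀≤j , pj , qj))

  pigeonhole : ∀ {A : Set} (L : List A) {P : ℕ → Set} (f : ℕ → A) → Unbounded P →
    (∀ j → P j → f j ∈ L) → ∃[ a ] (a ∈ L × Unbounded (λ j → P j × f j ≡ a))
  pigeonhole [] f unb into with j , _ , pj ← unb 0 with () ← into j pj
  pigeonhole (a ∷ L) {P} f unb into with em {Unbounded (λ j → P j × f j ≡ a)}
  ... | yes often = a , here refl , often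
  ... | no ¬often =
    let (b , b∈L , often) = pigeonhole L f (unbounded-split unb ¬often) into′
    in b , there b∈L , unbounded-mono (λ j ((pj , _) , fj≡b) → pj , fj≡b) often
    where
    into′ : ∀ j → P j × f j ≢ a → f j ∈ L
    into′ j (pj , fj≢a) with into j pj
    ... | here fj≡a = ⊥-elim (fj≢a fj≡a)
    ... | there fj∈L = fj∈L

  AgreeBelow : ∀ {A : Set} → ℕ → (ℕ → A) → (ℕ → A) → Set
  AgreeBelow n π π′ = ∀ t → t < n → π t ≡ π′ t

  module König {A : Set} (L : List A) {P : ℕ → Set} (f : ℕ → ℕ → A) (unb : Unbounded P)
               (into : ∀ j t → P j → f j t ∈ L) where

    Shared : (ℕ → A) → ℕ → Set
    Shared π n = Unbounded (λ j → P j × AgreeBelow n (f j) π)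

    extend : (ℕ → A) → ℕ → A → ℕ → A
    extend π n a t with t <? n
    ... | yes _ = π t
    ... | no _ = a

    extend-below : ∀ π n a t → t < n → extend π n a t ≡ π t
    extend-below π n a t t<n with t <? n
    ... | yes _ = refl
    ... | no t≮n = ⊥-elim (t≮n t<n)

    extend-at : ∀ π n a → extend π n a n ≡ a
    extend-at π n a with n <? n
    ... | yes n<n = ⊥-elim (<-irrefl refl n<n)
    ... | no _ = refl

    -- Stage n fixes the first n values; the next value is chosen by pigeonhole.
    stage : ∀ n → Σ (ℕ → A) λ π → Shared π n
    stage zero = f (proj₁ (unb 0)) , unbounded-mono (λ j pj → pj , λ _ ()) unb
    stage (suc n)
      with a , _ , often ← pigeonhole L (λ j → f j n) (proj₂ (stage n)) (λ j s → into j n (proj₁ s)) =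
      extend π n a , unbounded-mono agree often
      where
      π = proj₁ (stage n)

      agree : ∀ j → (P j × AgreeBelow n (f j) π) × f j n ≡ a →
              P j × AgreeBelow (suc n) (f j) (extend π n a)
      agree j ((pj , below) , at-n) = pj , λ t t< → case t t< (m<1+n⇒m<n∨m≡n t<)
        where
        case : ∀ t → t < suc n → t < n ⊎ t ≡ n → f j t ≡ extend π n a t
        case t _ (inj₁ t<n) = ≡-trans (below t t<n) (sym (extend-below π n a t t<n))
        case t _ (inj₂ refl) = ≡-trans at-n (sym (extend-at π t a))

    limit : ℕ → A
    limit t = proj₁ (stage (suc t)) t

    stage-stable : ∀ n t → t < n → proj₁ (stage n) t ≡ limit t
    stage-stable (suc n) t t< with m<1+n⇒m<n∨m≡n t<
    ... | inj₁ t<n = ≡-trans (extend-below _ n _ t t<n) (stage-stable n t t<n)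
    ... | inj₂ refl = refl

    limit-shared : ∀ n → Shared limit n
    limit-shared n = unbounded-mono
      (λ j (pj , below) → pj , λ t t< → ≡-trans (below t t<) (stage-stable n t t<)) (proj₂ (stage n))

  record Witness {s g k : ℕ} (T : NRT s g k) (d₀ : ℕ) (x : InWord s) (i j : ℕ) : Set where
    field
      x′ : InWord s
      y₁ y′ : OutWord g
      graph₁ : Graph T d₀ x y₁
      graph′ : Graph T d₀ x′ y′
      agree : Agree T d₀ j x x′
      pos : ℕ
      pos<i : pos < i
      differ : y₁ pos ≢ y′ pos

  discontinuity-witness : ∀ {s g k} (T : NRT s g k) d₀ x → ¬ ContinuousAt T d₀ x →
    ∃[ i ] (∀ j → Witness T d₀ x i j)
  discontinuity-witness T d₀ x discont with i , ¬bound ← ¬∀⇒∃¬ discont = i , witness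
    where
    witness : ∀ j → Witness T d₀ x i j
    witness j =
      let (x′ , ¬∀y₁) = ¬∀⇒∃¬ (λ bound → ¬bound (j , bound))
          (y₁ , ¬∀y′) = ¬∀⇒∃¬ ¬∀y₁
          (y′ , ¬→₁) = ¬∀⇒∃¬ ¬∀y′
          (graph₁ , ¬→₂) = ¬→⇒×¬ ¬→₁
          (graph′ , ¬→₃) = ¬→⇒×¬ ¬→₂
          (agree , ¬agree) = ¬→⇒×¬ ¬→₃
          (pos , ¬→₄) = ¬∀⇒∃¬ ¬agree
          (pos<i , differ) = ¬→⇒×¬ ¬→₄
      in record { x′ = x′ ; y₁ = y₁ ; y′ = y′ ; graph₁ = graph₁ ; graph′ = graph′
                ; agree = agree ; pos = pos ; pos<i = pos<i ; differ = differ }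

module Counting {A : Set} where

  remove : ∀ {a : A} (ys : List A) → a ∈ ys → List A
  remove (y ∷ ys) (here _) = ys
  remove (y ∷ ys) (there a∈) = y ∷ remove ys a∈

  length-remove : ∀ {a : A} (ys : List A) (a∈ : a ∈ ys) → suc (length (remove ys a∈)) ≡ length ys
  length-remove (y ∷ ys) (here _) = refl
  length-remove (y ∷ ys) (there a∈) = cong suc (length-remove ys a∈)

  ∈-remove : ∀ {a b : A} (ys : List A) (a∈ : a ∈ ys) → b ∈ ys → b ≢ a → b ∈ remove ys a∈
  ∈-remove (y ∷ ys) (here refl) (here refl) b≢a = ⊥-elim (b≢a refl)
  ∈-remove (y ∷ ys) (here _) (there b∈) _ = b∈
  ∈-remove (y ∷ ys) (there _) (here b≡y) _ = here b≡y
  ∈-remove (y ∷ ys) (there a∈) (there b∈) b≢a = there (∈-remove ys a∈ b∈ b≢a)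

  unique-length : ∀ (xs ys : List A) → Unique xs → (∀ {a} → a ∈ xs → a ∈ ys) →
    length xs ≤ length ys
  unique-length [] ys _ _ = z≤n
  unique-length (a ∷ as) ys (a∉as ∷ unique) sub =
    subst (suc (length as) ≤_) (length-remove ys a∈ys)
      (s≤s (unique-length as (remove ys a∈ys) unique
        (λ b∈as → ∈-remove ys a∈ys (sub (there b∈as)) (λ b≡a → All.lookup a∉as b∈as (sym b≡a)))))
    where
    a∈ys = sub (here refl)

open Counting using (unique-length)

outside : ∀ (xs ys : List ℕ) → Unique xs → length ys < length xs → ∃[ a ] (a ∈ xs × a ∉ ys)
outside xs ys unique ys<xs with all? (_∈? ys) xs
... | yes all-in =
  ⊥-elim (<-irrefl refl (≤-<-trans (unique-length xs ys unique (All.lookup all-in)) ys<xs))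
... | no ¬all-in = find (¬All⇒Any¬ (_∈? ys) xs ¬all-in)

-- 2k + 3 distinct values of X, among them d₀, give a supply for every pinned value:
-- the partner avoids d₀ and the fresh value avoids 2k + 1 values.
supply : ∀ {k} (X : ℕ → Set) (xs : List ℕ) → 2 * k + 3 ≤ length xs → Unique xs → All X xs →
  ∀ d₀ → X d₀ → ∀ v → Supply k X d₀ v
supply {k} X xs enough unique inX d₀ X-d₀ v = record
  { partner = proj₁ partner-spec
  ; partner∈X = proj₁ (proj₂ partner-spec)
  ; partner≡d₀ = proj₂ (proj₂ partner-spec)
  ; fresh = λ τ σ → proj₁ (fresh-spec τ σ)
  ; fresh∈X = λ τ σ → All.lookup inX (proj₁ (proj₂ (fresh-spec τ σ)))
  ; fresh-new = λ τ σ → proj₂ (proj₂ (fresh-spec τ σ))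
  }
  where
  two≤ : 2 ≤ length xs
  two≤ = ≤-trans (s≤s (s≤s z≤n)) (≤-trans (m≤n+m 3 (2 * k)) enough)

  partner-spec : ∃[ c ] (X c × (v ≡ d₀) ⇔ (c ≡ d₀))
  partner-spec with v ≟ d₀
  ... | yes v≡d₀ = d₀ , X-d₀ , mk⇔ (λ _ → refl) (λ _ → v≡d₀)
  ... | no v≢d₀ with c , c∈xs , c∉[d₀] ← outside xs (d₀ ∷ []) unique two≤ =
    c , All.lookup inX c∈xs , mk⇔ (λ v≡d₀ → ⊥-elim (v≢d₀ v≡d₀)) (λ c≡d₀ → ⊥-elim (c∉[d₀] (here c≡d₀)))

  avoided : Valuation k → Valuation k → List ℕ
  avoided τ σ = proj₁ partner-spec ∷ List.tabulate τ ++ List.tabulate σ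

  few-avoided : ∀ τ σ → length (avoided τ σ) < length xs
  few-avoided τ σ = subst (_< length xs) (sym length-avoided) (≤-trans bound enough)
    where
    length-avoided : length (avoided τ σ) ≡ suc (k + k)
    length-avoided = begin
      suc (length (List.tabulate τ ++ List.tabulate σ))
        ≡⟨ cong suc (length-++ (List.tabulate τ)) ⟩
      suc (length (List.tabulate τ) + length (List.tabulate σ))
        ≡⟨ cong₂ (λ a b → suc (a + b)) (length-tabulate τ) (length-tabulate σ) ⟩
      suc (k + k)
        ∎
      where open ≡-Reasoning

    bound : suc (suc (k + k)) ≤ 2 * k + 3
    bound rewrite +-identityʳ k | +-comm (k + k) 3 = n≤1+n _

  fresh-spec : ∀ τ σ → ∃[ a ] (a ∈ xs × a ∉ avoided τ σ)
  fresh-spec τ σ = outside xs (avoided τ σ) unique (few-avoided τ σ)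

module Discontinuity (em : ExcludedMiddle 0ℓ) {s g k : ℕ} (T : NRT s g k) (d₀ : ℕ)
  (standing : StandingAssumption T d₀) (functional : Functional T d₀)
  (X : ℕ → Set) (X-d₀ : X d₀) (supply-for : ∀ v → Supply k X d₀ v)
  (x : InWord s) (y : OutWord g) (graph : Graph T d₀ x y) (discont : ¬ ContinuousAt T d₀ x)
  where

  open Classical em

  i : ℕ
  i = proj₁ (discontinuity-witness T d₀ x discont)

  witness : ∀ j → Witness T d₀ x i j
  witness = proj₂ (discontinuity-witness T d₀ x discont)

  recurring : ∃[ p ] (p ∈ upTo i × Unbounded (λ j → ⊤ × Witness.pos (witness j) ≡ p))
  recurring = pigeonhole (upTo i) (λ j → Witness.pos (witness j)) (λ m → m , ≤-refl , ⋆)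
                         (λ j _ → ∈-upTo⁺ (Witness.pos<i (witness j)))

  p* : ℕ
  p* = proj₁ recurring

  ρ : Run T d₀ x
  ρ = proj₁ graph

  run′ : ∀ j → Run T d₀ (Witness.x′ (witness j))
  run′ j = proj₁ (Witness.graph′ (witness j))

  -- Rename along the run of x and a limit of the runs on the recurring witnesses,
  -- pinning the datum of the letter of y at position p*.
  open Renaming T d₀ X X-d₀ (proj₂ (y p*)) (supply-for (proj₂ (y p*)))
  open König (Δ T) (λ j → trans (run′ j)) (proj₂ (proj₂ recurring)) (λ j t _ → inΔ (run′ j) t)

  module Z = Renamed x (trans ρ) limit

  image : ∃[ y′ ] (Graph T d₀ Z.z y′ × ∀ p → Corresponds (y p) (y′ p))
  image = Z.Follow.renamed-graph true ρ (λ _ → refl) standing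
            (proj₁ (proj₂ graph)) (proj₂ (proj₂ graph))

  y-z : OutWord g
  y-z = proj₁ image

  graph-z : Graph T d₀ Z.z y-z
  graph-z = proj₁ (proj₂ image)

  module Near (m : ℕ) where
    j : ℕ
    j = proj₁ (limit-shared m m)

    m≤j : m ≤ j
    m≤j = proj₁ (proj₂ (limit-shared m m))

    recurs : Witness.pos (witness j) ≡ p*
    recurs = proj₂ (proj₁ (proj₂ (proj₂ (limit-shared m m))))

    follows-limit : AgreeBelow m (trans (run′ j)) limit
    follows-limit = proj₂ (proj₂ (proj₂ (limit-shared m m)))

    open Witness (witness j)

    module Z′ = Renamed x′ (trans ρ) (trans (run′ j))

    image′ : ∃[ y″ ] (Graph T d₀ Z′.z y″ × ∀ p → Corresponds (y′ p) (y″ p))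
    image′ = Z′.Follow.renamed-graph false (run′ j) (λ _ → refl) standing
               (proj₁ (proj₂ graph′)) (proj₂ (proj₂ graph′))

    y-z′ : OutWord g
    y-z′ = proj₁ image′

    graph-z′ : Graph T d₀ Z′.z y-z′
    graph-z′ = proj₁ (proj₂ image′)

    close : Agree T d₀ m Z.z Z′.z
    close = renaming-causal x x′ (trans ρ) (trans ρ) limit (trans (run′ j)) m
              (λ t t< → agree t (<-≤-trans t< m≤j)) (λ _ _ → refl)
              (λ t t< → sym (follows-limit t t<))

    -- By functionality y₁ = y, so y differs from y′ at p*, and so do the renamings.
    apart : y-z p* ≢ y-z′ p*
    apart = corresponds-separates (proj₂ (proj₂ image) p*) (proj₂ (proj₂ image′) p*) refl y≢y′
      where
      y≢y′ : y p* ≢ y′ p*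
      y≢y′ eq = differ (subst (λ q → y₁ q ≡ y′ q) (sym recurs)
                              (≡-trans (functional x y₁ y graph₁ graph p*) eq))

  discontinuous-at-z : ¬ ContinuousAt T d₀ Z.z
  discontinuous-at-z continuous = Near.apart J images-agree
    where
    J : ℕ
    J = proj₁ (continuous i)

    open Near J using (module Z′; y-z′; graph-z′; close)

    images-agree : y-z p* ≡ y-z′ p*
    images-agree = proj₂ (continuous i) Z′.z y-z y-z′ graph-z graph-z′ close
                         p* (∈-upTo⁻ (proj₁ (proj₂ recurring)))

  discontinuous-in-X : ∃[ z ] ((∀ t → X (proj₂ (z t))) × NotContinuousAt T d₀ z)
  discontinuous-in-X = Z.z , (λ t → proj₂ (Z.datum-matches t)) , (y-z , graph-z) , discontinuous-at-z

theorem6 : ExcludedMiddle 0ℓ →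
    ∀ {s g k : ℕ} (T : NRT s g k) (d₀ : ℕ) →
    StandingAssumption T d₀ → Functional T d₀ →
    (X : ℕ → Set) → AtLeast (2 * k + 3) X → X d₀ →
    (∃[ x ] NotContinuousAt T d₀ x) ⇔
    (∃[ z ] ((∀ i → X (proj₂ (z i))) × NotContinuousAt T d₀ z))
theorem6 em T d₀ standing functional X (xs , enough , unique , inX) X-d₀ = mk⇔ into-X forget-X
  where
  into-X : ∃[ x ] NotContinuousAt T d₀ x →
           ∃[ z ] ((∀ i → X (proj₂ (z i))) × NotContinuousAt T d₀ z)
  into-X (x , (y , graph) , discont) =
    Discontinuity.discontinuous-in-X em T d₀ standing functional X X-d₀
      (supply X xs enough unique inX d₀ X-d₀) x y graph discont

  forget-X : ∃[ z ] ((∀ i → X (proj₂ (z i))) × NotContinuousAt T d₀ z) →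
             ∃[ x ] NotContinuousAt T d₀ x
  forget-X (z , _ , discont) = z , discont
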